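{- Let $A$ be a commutative ring and $v,w,s,t\in A^3$. Suppose that $[s,t,v]$ is a unit of $A$ and that the entries of $v\times w$ generate the unit ideal. Then the entries of $(s\times t)\times(v\times w)$ generate the unit ideal.
   Context: For $x,y\in A^3$: $x\times y=(x_2y_3-x_3y_2,\;x_3y_1-x_1y_3,\;x_1y_2-x_2y_1)$, and $[x,y,z]$ is the determinant of the $3\times 3$ matrix with columns $x,y,z$. -}

module Defs where

open import Algebra.Bundles using (CommutativeRing)
open import Data.Product using (Σ; ∃; _×_; _,_)
open import Level using (_⊔_)

module Cross {c ℓ} (R : CommutativeRing c ℓ) where
  open CommutativeRing R

  A³ : Set c
  A³ = Carrier × Carrier × Carrier

  _⨯_ : A³ → A³ → A³
  (x₁ , x₂ , x₃) ⨯ (y₁ , y₂ , y₃) =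
    ( x₂ * y₃ - x₃ * y₂
    , x₃ * y₁ - x₁ * y₃
    , x₁ * y₂ - x₂ * y₁ )

  det3 : A³ → A³ → A³ → Carrier
  det3 (x₁ , x₂ , x₃) (y₁ , y₂ , y₃) (z₁ , z₂ , z₃) =
      x₁ * (y₂ * z₃ - y₃ * z₂)
    - y₁ * (x₂ * z₃ - x₃ * z₂)
    + z₁ * (x₂ * y₃ - x₃ * y₂)

  IsUnit : Carrier → Set (c ⊔ ℓ)
  IsUnit a = ∃ λ b → a * b ≈ 1#

  UnimodularEntries : A³ → Set (c ⊔ ℓ)
  UnimodularEntries (x₁ , x₂ , x₃) =
    ∃ λ a → ∃ λ b → ∃ λ d → a * x₁ + b * x₂ + d * x₃ ≈ 1#

{-# OPTIONS --safe #-}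
module Submission where

-- Put u = v ⨯ w and p = s ⨯ t, and pick x with x · u = 1. The Binet–Cauchy identity
-- gives (v ⨯ x) · (p ⨯ u) = (v · p)(x · u) - (v · u)(x · p) = [s,t,v] · 1 - 0, a unit,
-- so e (v ⨯ x), with e the inverse of [s,t,v], exhibits 1 in the ideal spanned by the entries of p ⨯ u.

open import Defs
open import Algebra.Bundles using (CommutativeRing)
open import Algebra.Solver.Ring.AlmostCommutativeRing
  using (fromCommutativeRing; _-Raw-AlmostCommutative⟶_; Induced-equivalence)
open import Data.Maybe using (just; nothing)
open import Data.Nat as ℕ using (ℕ; zero; suc)
import Data.Nat.Properties as ℕ
open import Data.Integer as ℤ using (ℤ; +_; -[1+_]; +0; +[1+_]; sign; ∣_∣; _◃_; _⊖_)
import Data.Integer.Properties as ℤ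
open import Data.Product using (_,_)
open import Data.Sign as Sign using (Sign)
open import Relation.Binary.Definitions using (WeaklyDecidable; _Respects_)
import Relation.Binary.PropositionalEquality as P
open import Relation.Nullary using (yes; no)

-- The library's solvers for an abstract ring take coefficients in the carrier, where
-- 1# - 1# is not recognised as 0#; coefficients from ℤ, mapped into R, make them complete.
module IntegerCoefficientSolver {c ℓ} (R : CommutativeRing c ℓ) where
  open CommutativeRing R
  open import Relation.Binary.Reasoning.Setoid setoid
  open import Algebra.Definitions.RawMonoid +-rawMonoid using (_×_)
  open import Algebra.Properties.Monoid.Mult +-monoid using (×-homo-+)
  open import Algebra.Properties.Semiring.Mult semiring using (×1-homo-*)
  open import Algebra.Properties.Ring ring using (-1*x≈-x)
  open import Algebra.Properties.AbelianGroup +-abelianGroup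
    using (⁻¹-involutive; ε⁻¹≈ε; ⁻¹-∙-comm)
  open import Algebra.Properties.CommutativeSemigroup +-commutativeSemigroup
    using () renaming (interchange to +-interchange)
  open import Algebra.Properties.CommutativeSemigroup *-commutativeSemigroup
    using () renaming (interchange to *-interchange)

  fromℤ : ℤ → Carrier
  fromℤ (+ n)    = n × 1#
  fromℤ -[1+ n ] = - (suc n × 1#)

  x-0#≈x : ∀ x → x - 0# ≈ x
  x-0#≈x x = trans (+-congˡ ε⁻¹≈ε) (+-identityʳ x)

  [x+y]-[x+z]≈y-z : ∀ x y z → (x + y) - (x + z) ≈ y - z
  [x+y]-[x+z]≈y-z x y z = begin
    (x + y) - (x + z)       ≈⟨ +-congˡ (sym (⁻¹-∙-comm x z)) ⟩
    (x + y) + (- x + - z)   ≈⟨ +-interchange x y (- x) (- z) ⟩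
    (x - x) + (y - z)       ≈⟨ +-congʳ (-‿inverseʳ x) ⟩
    0# + (y - z)            ≈⟨ +-identityˡ (y - z) ⟩
    y - z                   ∎

  fromℤ-homo-⊖ : ∀ m n → fromℤ (m ⊖ n) ≈ m × 1# - n × 1#
  fromℤ-homo-⊖ zero    zero    = sym (x-0#≈x 0#)
  fromℤ-homo-⊖ zero    (suc n) = sym (+-identityˡ _)
  fromℤ-homo-⊖ (suc m) zero    = sym (x-0#≈x _)
  fromℤ-homo-⊖ (suc m) (suc n) = begin
    fromℤ (suc m ⊖ suc n)             ≡⟨ P.cong fromℤ (ℤ.[1+m]⊖[1+n]≡m⊖n m n) ⟩
    fromℤ (m ⊖ n)                     ≈⟨ fromℤ-homo-⊖ m n ⟩
    m × 1# - n × 1#                   ≈⟨ sym ([x+y]-[x+z]≈y-z 1# _ _) ⟩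
    suc m × 1# - suc n × 1#           ∎

  fromℤ-homo-+ : ∀ i j → fromℤ (i ℤ.+ j) ≈ fromℤ i + fromℤ j
  fromℤ-homo-+ -[1+ m ] -[1+ n ] = begin
    - (suc (suc (m ℕ.+ n)) × 1#)      ≡⟨ P.cong (λ k → - (suc k × 1#)) (P.sym (ℕ.+-suc m n)) ⟩
    - ((suc m ℕ.+ suc n) × 1#)        ≈⟨ -‿cong (×-homo-+ 1# (suc m) (suc n)) ⟩
    - (suc m × 1# + suc n × 1#)       ≈⟨ sym (⁻¹-∙-comm _ _) ⟩
    - (suc m × 1#) + - (suc n × 1#)   ∎
  fromℤ-homo-+ -[1+ m ] (+ n)    = trans (fromℤ-homo-⊖ n (suc m)) (+-comm _ _)
  fromℤ-homo-+ (+ m)    -[1+ n ] = fromℤ-homo-⊖ m (suc n)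
  fromℤ-homo-+ (+ m)    (+ n)    = ×-homo-+ 1# m n

  fromSign : Sign → Carrier
  fromSign Sign.+ = 1#
  fromSign Sign.- = - 1#

  fromSign-homo-* : ∀ s t → fromSign (s Sign.* t) ≈ fromSign s * fromSign t
  fromSign-homo-* Sign.- Sign.- = sym (trans (-1*x≈-x _) (⁻¹-involutive _))
  fromSign-homo-* Sign.- Sign.+ = sym (*-identityʳ _)
  fromSign-homo-* Sign.+ Sign.- = sym (*-identityˡ _)
  fromSign-homo-* Sign.+ Sign.+ = sym (*-identityˡ _)

  fromℤ-◃ : ∀ s n → fromℤ (s ◃ n) ≈ fromSign s * n × 1#
  fromℤ-◃ s      zero    = sym (zeroʳ _)
  fromℤ-◃ Sign.+ (suc n) = sym (*-identityˡ _)
  fromℤ-◃ Sign.- (suc n) = sym (-1*x≈-x _)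

  fromℤ≈sign*abs : ∀ i → fromℤ i ≈ fromSign (sign i) * ∣ i ∣ × 1#
  fromℤ≈sign*abs i = begin
    fromℤ i                   ≡⟨ P.cong fromℤ (P.sym (ℤ.◃-inverse i)) ⟩
    fromℤ (sign i ◃ ∣ i ∣)    ≈⟨ fromℤ-◃ (sign i) ∣ i ∣ ⟩
    fromSign (sign i) * ∣ i ∣ × 1# ∎

  fromℤ-homo-* : ∀ i j → fromℤ (i ℤ.* j) ≈ fromℤ i * fromℤ j
  fromℤ-homo-* i j = begin
    fromℤ (sign i Sign.* sign j ◃ ∣ i ∣ ℕ.* ∣ j ∣)
      ≈⟨ fromℤ-◃ (sign i Sign.* sign j) (∣ i ∣ ℕ.* ∣ j ∣) ⟩
    fromSign (sign i Sign.* sign j) * (∣ i ∣ ℕ.* ∣ j ∣) × 1#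
      ≈⟨ *-cong (fromSign-homo-* (sign i) (sign j)) (×1-homo-* ∣ i ∣ ∣ j ∣) ⟩
    (fromSign (sign i) * fromSign (sign j)) * (∣ i ∣ × 1# * ∣ j ∣ × 1#)
      ≈⟨ *-interchange _ _ _ _ ⟩
    (fromSign (sign i) * ∣ i ∣ × 1#) * (fromSign (sign j) * ∣ j ∣ × 1#)
      ≈⟨ sym (*-cong (fromℤ≈sign*abs i) (fromℤ≈sign*abs j)) ⟩
    fromℤ i * fromℤ j ∎

  fromℤ-homo-neg : ∀ i → fromℤ (ℤ.- i) ≈ - fromℤ i
  fromℤ-homo-neg -[1+ n ] = sym (⁻¹-involutive _)
  fromℤ-homo-neg +0       = sym ε⁻¹≈ε
  fromℤ-homo-neg +[1+ n ] = refl

  fromℤ-homomorphism : ℤ.+-*-rawRing -Raw-AlmostCommutative⟶ fromCommutativeRing R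
  fromℤ-homomorphism = record
    { ⟦_⟧    = fromℤ
    ; +-homo = fromℤ-homo-+
    ; *-homo = fromℤ-homo-*
    ; -‿homo = fromℤ-homo-neg
    ; 0-homo = refl
    ; 1-homo = +-identityʳ 1#
    }

  private
    _≟_ : WeaklyDecidable (Induced-equivalence fromℤ-homomorphism)
    i ≟ j with i ℤ.≟ j
    ... | yes P.refl = just refl
    ... | no _       = nothing

  open import Algebra.Solver.Ring ℤ.+-*-rawRing (fromCommutativeRing R) fromℤ-homomorphism _≟_
    public using (Polynomial; con; solve; _:=_; _:+_; _:*_; _:-_)

module TripleProducts {c ℓ} (R : CommutativeRing c ℓ) where
  open CommutativeRing R
  open Cross R
  open IntegerCoefficientSolver R
  open import Relation.Binary.Reasoning.Setoid setoid
  open import Data.Product using (_×_)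

  infixl 7 _·_
  _·_ : A³ → A³ → Carrier
  (x₁ , x₂ , x₃) · (y₁ , y₂ , y₃) = x₁ * y₁ + x₂ * y₂ + x₃ * y₃

  -- Evaluating these unfolds definitionally to _⨯_ and _·_, so solver goals read as vector identities.
  module Formal {n : ℕ} where
    P³ : Set
    P³ = Polynomial n × Polynomial n × Polynomial n

    _⨯ᴾ_ : P³ → P³ → P³
    (x₁ , x₂ , x₃) ⨯ᴾ (y₁ , y₂ , y₃) =
      ( x₂ :* y₃ :- x₃ :* y₂
      , x₃ :* y₁ :- x₁ :* y₃
      , x₁ :* y₂ :- x₂ :* y₁ )

    _·ᴾ_ : P³ → P³ → Polynomial n
    (x₁ , x₂ , x₃) ·ᴾ (y₁ , y₂ , y₃) = x₁ :* y₁ :+ x₂ :* y₂ :+ x₃ :* y₃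
  open Formal

  binet-cauchy : ∀ a b c d → (a ⨯ b) · (c ⨯ d) ≈ (a · c) * (b · d) - (a · d) * (b · c)
  binet-cauchy (a₁ , a₂ , a₃) (b₁ , b₂ , b₃) (c₁ , c₂ , c₃) (d₁ , d₂ , d₃) =
    solve 12 (λ a₁ a₂ a₃ b₁ b₂ b₃ c₁ c₂ c₃ d₁ d₂ d₃ →
      let a = (a₁ , a₂ , a₃); b = (b₁ , b₂ , b₃); c = (c₁ , c₂ , c₃); d = (d₁ , d₂ , d₃) in
      (a ⨯ᴾ b) ·ᴾ (c ⨯ᴾ d) := (a ·ᴾ c) :* (b ·ᴾ d) :- (a ·ᴾ d) :* (b ·ᴾ c))
      refl a₁ a₂ a₃ b₁ b₂ b₃ c₁ c₂ c₃ d₁ d₂ d₃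

  det3[x,y,z]≈z·[x⨯y] : ∀ x y z → det3 x y z ≈ z · (x ⨯ y)
  det3[x,y,z]≈z·[x⨯y] (x₁ , x₂ , x₃) (y₁ , y₂ , y₃) (z₁ , z₂ , z₃) =
    solve 9 (λ x₁ x₂ x₃ y₁ y₂ y₃ z₁ z₂ z₃ →
      x₁ :* (y₂ :* z₃ :- y₃ :* z₂) :- y₁ :* (x₂ :* z₃ :- x₃ :* z₂) :+ z₁ :* (x₂ :* y₃ :- x₃ :* y₂)
        := (z₁ , z₂ , z₃) ·ᴾ ((x₁ , x₂ , x₃) ⨯ᴾ (y₁ , y₂ , y₃)))
      refl x₁ x₂ x₃ y₁ y₂ y₃ z₁ z₂ z₃

  x·[x⨯y]≈0 : ∀ x y → x · (x ⨯ y) ≈ 0#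
  x·[x⨯y]≈0 (x₁ , x₂ , x₃) (y₁ , y₂ , y₃) =
    solve 6 (λ x₁ x₂ x₃ y₁ y₂ y₃ →
      let x = (x₁ , x₂ , x₃); y = (y₁ , y₂ , y₃) in
      x ·ᴾ (x ⨯ᴾ y) := con +0)
      refl x₁ x₂ x₃ y₁ y₂ y₃

  [v⨯x]·[p⨯[v⨯w]]≈[v·p]*[x·[v⨯w]] : ∀ v x p w →
    (v ⨯ x) · (p ⨯ (v ⨯ w)) ≈ (v · p) * (x · (v ⨯ w))
  [v⨯x]·[p⨯[v⨯w]]≈[v·p]*[x·[v⨯w]] v x p w = begin
    (v ⨯ x) · (p ⨯ (v ⨯ w))                                ≈⟨ binet-cauchy v x p (v ⨯ w) ⟩
    (v · p) * (x · (v ⨯ w)) - (v · (v ⨯ w)) * (x · p)      ≈⟨ +-congˡ (-‿cong (*-congʳ (x·[x⨯y]≈0 v w))) ⟩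
    (v · p) * (x · (v ⨯ w)) - 0# * (x · p)                 ≈⟨ +-congˡ (-‿cong (zeroˡ (x · p))) ⟩
    (v · p) * (x · (v ⨯ w)) - 0#                           ≈⟨ x-0#≈x _ ⟩
    (v · p) * (x · (v ⨯ w))                                ∎

  IsUnit-resp-≈ : IsUnit Respects _≈_
  IsUnit-resp-≈ a≈b (e , ae≈1) = e , trans (*-congʳ (sym a≈b)) ae≈1

  ·-unit⇒unimodular : ∀ x y → IsUnit (x · y) → UnimodularEntries y
  ·-unit⇒unimodular (x₁ , x₂ , x₃) (y₁ , y₂ , y₃) (e , [x·y]e≈1) =
    e * x₁ , e * x₂ , e * x₃ , trans (scale x₁ x₂ x₃ y₁ y₂ y₃ e) [x·y]e≈1
    where
    scale : ∀ x₁ x₂ x₃ y₁ y₂ y₃ e →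
      e * x₁ * y₁ + e * x₂ * y₂ + e * x₃ * y₃ ≈ (x₁ * y₁ + x₂ * y₂ + x₃ * y₃) * e
    scale = solve 7 (λ x₁ x₂ x₃ y₁ y₂ y₃ e →
      e :* x₁ :* y₁ :+ e :* x₂ :* y₂ :+ e :* x₃ :* y₃
        := ((x₁ , x₂ , x₃) ·ᴾ (y₁ , y₂ , y₃)) :* e) refl

lemma3p3 : ∀ {c ℓ} (R : CommutativeRing c ℓ) → let open Cross R in
           (v w s t : A³) →
           IsUnit (det3 s t v) →
           UnimodularEntries (v ⨯ w) →
           UnimodularEntries ((s ⨯ t) ⨯ (v ⨯ w))
lemma3p3 R v w s t det-unit (a , b , d , x·[v⨯w]≈1) =
  ·-unit⇒unimodular (v ⨯ x) _ (IsUnit-resp-≈ [s,t,v]≈[v⨯x]·[[s⨯t]⨯[v⨯w]] det-unit)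
  where
  open CommutativeRing R
  open Cross R
  open TripleProducts R
  open import Relation.Binary.Reasoning.Setoid setoid

  x : A³
  x = a , b , d

  [s,t,v]≈[v⨯x]·[[s⨯t]⨯[v⨯w]] : det3 s t v ≈ (v ⨯ x) · ((s ⨯ t) ⨯ (v ⨯ w))
  [s,t,v]≈[v⨯x]·[[s⨯t]⨯[v⨯w]] = begin
    det3 s t v                             ≈⟨ det3[x,y,z]≈z·[x⨯y] s t v ⟩
    v · (s ⨯ t)                            ≈⟨ sym (*-identityʳ _) ⟩
    v · (s ⨯ t) * 1#                       ≈⟨ *-congˡ (sym x·[v⨯w]≈1) ⟩
    v · (s ⨯ t) * (x · (v ⨯ w))            ≈⟨ sym ([v⨯x]·[p⨯[v⨯w]]≈[v·p]*[x·[v⨯w]] v x (s ⨯ t) w) ⟩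
    (v ⨯ x) · ((s ⨯ t) ⨯ (v ⨯ w))          ∎
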